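{- Let $\pi_1,\pi_2,\pi_3$ be permutations of $\mathbb{F}_2^m$ having the $(\mathcal{A}_m)$ property, and let $\sigma_1,\sigma_2,\sigma_3$ be permutations of $\mathbb{F}_2^m$ having the $(\mathcal{A}_m)$ property. Put $\pi_4=\pi_1+\pi_2+\pi_3$ and $\sigma_4=\sigma_1+\sigma_2+\sigma_3$. For $i\in\{1,2,3,4\}$ define $\phi_i\colon\mathbb{F}_2^{m+1}\to\mathbb{F}_2^{m+1}$ by $$\phi_i(y,y_{m+1})=\begin{cases}(\pi_i(y),1) & \text{if } y_{m+1}=1,\\ (\sigma_i(y),0) & \text{if } y_{m+1}=0,\end{cases}\qquad y\in\mathbb{F}_2^m,\ y_{m+1}\in\mathbb{F}_2.$$ Then $\phi_1,\phi_2,\phi_3$ are permutations of $\mathbb{F}_2^{m+1}$ having the $(\mathcal{A}_{m+1})$ property (and $\phi_1+\phi_2+\phi_3=\phi_4$).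
   Context: Three permutations $\tau_1,\tau_2,\tau_3$ of $\mathbb{F}_2^k$ are said to have the $(\mathcal{A}_k)$ property if (1) $\tau_4=\tau_1+\tau_2+\tau_3$ (pointwise sum in $\mathbb{F}_2^k$) is a permutation of $\mathbb{F}_2^k$, and (2) $\tau_4^{ -1}=\tau_1^{ -1}+\tau_2^{ -1}+\tau_3^{ -1}$. -}

module Defs where

open import Data.Bool using (Bool; true; false; _xor_)
open import Data.Nat using (ℕ; suc)
open import Data.Vec using (Vec; zipWith; init; last; _∷ʳ_)
open import Data.Product using (Σ; _×_; _,_)
open import Function.Bundles using (_↔_; Inverse)
open import Relation.Binary.PropositionalEquality using (_≡_)

V : ℕ → Set
V k = Vec Bool k

_⊕_ : ∀ {k} → V k → V k → V k
_⊕_ = zipWith _xor_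

infixl 6 _⊕_

Perm : ℕ → Set
Perm k = V k ↔ V k

sum3 : ∀ {k} → (V k → V k) → (V k → V k) → (V k → V k) → V k → V k
sum3 f g h x = f x ⊕ g x ⊕ h x

-- The (𝒜_k) property of three permutations τ₁ τ₂ τ₃:
-- τ₄ = τ₁+τ₂+τ₃ is a permutation (i.e. is the forward map of some permutation T₄)
-- and τ₄⁻¹ = τ₁⁻¹ + τ₂⁻¹ + τ₃⁻¹.
HasA : ∀ {k} → Perm k → Perm k → Perm k → Set
HasA {k} τ₁ τ₂ τ₃ =
  Σ (Perm k) λ τ₄ →
    (∀ x → Inverse.to τ₄ x ≡ sum3 (Inverse.to τ₁) (Inverse.to τ₂) (Inverse.to τ₃) x)
    × (∀ x → Inverse.from τ₄ x ≡ sum3 (Inverse.from τ₁) (Inverse.from τ₂) (Inverse.from τ₃) x)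

-- Gluing: (y, y_{m+1}) ↦ (π y, 1) if y_{m+1} = 1, (σ y, 0) if y_{m+1} = 0.
-- Elements of 𝔽₂^{m+1} are vectors whose last coordinate is y_{m+1}.
glue : ∀ {m} → (V m → V m) → (V m → V m) → V (suc m) → V (suc m)
glue π σ v with last v
... | true  = π (init v) ∷ʳ true
... | false = σ (init v) ∷ʳ false

{-# OPTIONS --safe #-}
-- Gluing acts independently on the two halves {y_{m+1} = 1} and {y_{m+1} = 0},
-- each of which it preserves. So glue π σ is a permutation with inverse
-- glue π⁻¹ σ⁻¹, and the pointwise sum of glued maps is the glued pointwise sum
-- (the last coordinate contributes b + b + b = b). Both conditions of (𝒜_{m+1})
-- therefore reduce to the corresponding conditions of (𝒜_m) on each half.
module Submission where

open import Defs
open import Data.Bool using (true; false; _xor_; if_then_else_)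
open import Data.Nat using (ℕ; suc)
open import Data.Vec using (Vec; []; _∷_; zipWith; _∷ʳ_; initLast)
open import Data.Vec.Properties using (init-∷ʳ; last-∷ʳ)
open import Data.Product using (Σ; _×_; _,_)
open import Function.Bundles using (Inverse; mk↔ₛ′)
open import Relation.Binary.PropositionalEquality
  using (_≡_; refl; sym; trans; cong; cong₂; module ≡-Reasoning)

open ≡-Reasoning

∷ʳ-elim : ∀ {a p} {A : Set a} {n} (P : Vec A (suc n) → Set p) →
          (∀ xs x → P (xs ∷ʳ x)) → ∀ v → P v
∷ʳ-elim P h v with initLast v
... | xs , x , refl = h xs x

zipWith-∷ʳ : ∀ {A B C : Set} {n} (f : A → B → C) (xs : Vec A n) (ys : Vec B n) x y →
             zipWith f (xs ∷ʳ x) (ys ∷ʳ y) ≡ zipWith f xs ys ∷ʳ f x y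
zipWith-∷ʳ f []       []       x y = refl
zipWith-∷ʳ f (a ∷ xs) (b ∷ ys) x y = cong (f a b ∷_) (zipWith-∷ʳ f xs ys x y)

xor-triple : ∀ b → (b xor b) xor b ≡ b
xor-triple true  = refl
xor-triple false = refl

⊕₃-∷ʳ : ∀ {k} (a c d : V k) b → (a ∷ʳ b) ⊕ (c ∷ʳ b) ⊕ (d ∷ʳ b) ≡ (a ⊕ c ⊕ d) ∷ʳ b
⊕₃-∷ʳ a c d b = begin
  (a ∷ʳ b) ⊕ (c ∷ʳ b) ⊕ (d ∷ʳ b)   ≡⟨ cong (_⊕ (d ∷ʳ b)) (zipWith-∷ʳ _xor_ a c b b) ⟩
  ((a ⊕ c) ∷ʳ (b xor b)) ⊕ (d ∷ʳ b) ≡⟨ zipWith-∷ʳ _xor_ (a ⊕ c) d (b xor b) b ⟩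
  (a ⊕ c ⊕ d) ∷ʳ ((b xor b) xor b)  ≡⟨ cong ((a ⊕ c ⊕ d) ∷ʳ_) (xor-triple b) ⟩
  (a ⊕ c ⊕ d) ∷ʳ b                  ∎

module _ {m : ℕ} where

  glue-∷ʳ : ∀ (f g : V m → V m) ys b →
            glue f g (ys ∷ʳ b) ≡ (if b then f else g) ys ∷ʳ b
  glue-∷ʳ f g ys true  rewrite last-∷ʳ true ys  | init-∷ʳ true ys  = refl
  glue-∷ʳ f g ys false rewrite last-∷ʳ false ys | init-∷ʳ false ys = refl

  glue-cong : ∀ {f f′ g g′ : V m → V m} → (∀ x → f x ≡ f′ x) → (∀ x → g x ≡ g′ x) →
              ∀ v → glue f g v ≡ glue f′ g′ v
  glue-cong {f} {f′} {g} {g′} f≗f′ g≗g′ = ∷ʳ-elim _ on-halves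
    where
    on-halves : ∀ ys b → glue f g (ys ∷ʳ b) ≡ glue f′ g′ (ys ∷ʳ b)
    on-halves ys b = begin
      glue f g (ys ∷ʳ b)             ≡⟨ glue-∷ʳ f g ys b ⟩
      (if b then f else g) ys ∷ʳ b   ≡⟨ cong (_∷ʳ b) (branch b) ⟩
      (if b then f′ else g′) ys ∷ʳ b ≡⟨ sym (glue-∷ʳ f′ g′ ys b) ⟩
      glue f′ g′ (ys ∷ʳ b)           ∎
      where
      branch : ∀ b → (if b then f else g) ys ≡ (if b then f′ else g′) ys
      branch true  = f≗f′ ys
      branch false = g≗g′ ys

  glue-∘ : ∀ (f g f′ g′ : V m → V m) v →
           glue f g (glue f′ g′ v) ≡ glue (λ x → f (f′ x)) (λ x → g (g′ x)) v
  glue-∘ f g f′ g′ = ∷ʳ-elim _ on-halves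
    where
    on-halves : ∀ ys b → glue f g (glue f′ g′ (ys ∷ʳ b))
                       ≡ glue (λ x → f (f′ x)) (λ x → g (g′ x)) (ys ∷ʳ b)
    on-halves ys b = begin
      glue f g (glue f′ g′ (ys ∷ʳ b))
        ≡⟨ cong (glue f g) (glue-∷ʳ f′ g′ ys b) ⟩
      glue f g ((if b then f′ else g′) ys ∷ʳ b)
        ≡⟨ glue-∷ʳ f g _ b ⟩
      (if b then f else g) ((if b then f′ else g′) ys) ∷ʳ b
        ≡⟨ cong (_∷ʳ b) (branch b) ⟩
      (if b then (λ x → f (f′ x)) else (λ x → g (g′ x))) ys ∷ʳ b
        ≡⟨ sym (glue-∷ʳ _ _ ys b) ⟩
      glue (λ x → f (f′ x)) (λ x → g (g′ x)) (ys ∷ʳ b) ∎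
      where
      branch : ∀ b → (if b then f else g) ((if b then f′ else g′) ys)
                   ≡ (if b then (λ x → f (f′ x)) else (λ x → g (g′ x))) ys
      branch true  = refl
      branch false = refl

  glue-id : ∀ v → glue (λ x → x) (λ x → x) v ≡ v
  glue-id = ∷ʳ-elim _ on-halves
    where
    on-halves : ∀ ys b → glue (λ x → x) (λ x → x) (ys ∷ʳ b) ≡ ys ∷ʳ b
    on-halves ys true  = glue-∷ʳ _ _ ys true
    on-halves ys false = glue-∷ʳ _ _ ys false

  glue-inverse : ∀ {f g f′ g′ : V m → V m} → (∀ x → f (f′ x) ≡ x) → (∀ x → g (g′ x) ≡ x) →
                 ∀ v → glue f g (glue f′ g′ v) ≡ v
  glue-inverse {f} {g} {f′} {g′} ff′ gg′ v = begin
    glue f g (glue f′ g′ v)                  ≡⟨ glue-∘ f g f′ g′ v ⟩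
    glue (λ x → f (f′ x)) (λ x → g (g′ x)) v ≡⟨ glue-cong ff′ gg′ v ⟩
    glue (λ x → x) (λ x → x) v               ≡⟨ glue-id v ⟩
    v                                        ∎

  sum3-glue : ∀ (f₁ f₂ f₃ g₁ g₂ g₃ : V m → V m) v →
              sum3 (glue f₁ g₁) (glue f₂ g₂) (glue f₃ g₃) v ≡ glue (sum3 f₁ f₂ f₃) (sum3 g₁ g₂ g₃) v
  sum3-glue f₁ f₂ f₃ g₁ g₂ g₃ = ∷ʳ-elim _ on-halves
    where
    on-halves : ∀ ys b → sum3 (glue f₁ g₁) (glue f₂ g₂) (glue f₃ g₃) (ys ∷ʳ b)
                       ≡ glue (sum3 f₁ f₂ f₃) (sum3 g₁ g₂ g₃) (ys ∷ʳ b)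
    on-halves ys b = begin
      sum3 (glue f₁ g₁) (glue f₂ g₂) (glue f₃ g₃) (ys ∷ʳ b)
        ≡⟨ cong₂ _⊕_ (cong₂ _⊕_ (glue-∷ʳ f₁ g₁ ys b) (glue-∷ʳ f₂ g₂ ys b)) (glue-∷ʳ f₃ g₃ ys b) ⟩
      (h₁ ys ∷ʳ b) ⊕ (h₂ ys ∷ʳ b) ⊕ (h₃ ys ∷ʳ b)
        ≡⟨ ⊕₃-∷ʳ (h₁ ys) (h₂ ys) (h₃ ys) b ⟩
      sum3 h₁ h₂ h₃ ys ∷ʳ b
        ≡⟨ cong (_∷ʳ b) (branch b) ⟩
      (if b then sum3 f₁ f₂ f₃ else sum3 g₁ g₂ g₃) ys ∷ʳ b
        ≡⟨ sym (glue-∷ʳ (sum3 f₁ f₂ f₃) (sum3 g₁ g₂ g₃) ys b) ⟩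
      glue (sum3 f₁ f₂ f₃) (sum3 g₁ g₂ g₃) (ys ∷ʳ b) ∎
      where
      h₁ h₂ h₃ : V m → V m
      h₁ = if b then f₁ else g₁
      h₂ = if b then f₂ else g₂
      h₃ = if b then f₃ else g₃

      branch : ∀ b → sum3 (if b then f₁ else g₁) (if b then f₂ else g₂) (if b then f₃ else g₃) ys
                   ≡ (if b then sum3 f₁ f₂ f₃ else sum3 g₁ g₂ g₃) ys
      branch true  = refl
      branch false = refl

  glue↔ : Perm m → Perm m → Perm (suc m)
  glue↔ π σ = mk↔ₛ′ (glue (Inverse.to π) (Inverse.to σ)) (glue (Inverse.from π) (Inverse.from σ))
    (glue-inverse (Inverse.strictlyInverseˡ π) (Inverse.strictlyInverseˡ σ))
    (glue-inverse (Inverse.strictlyInverseʳ π) (Inverse.strictlyInverseʳ σ))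

  glue↔-HasA : ∀ (π₁ π₂ π₃ σ₁ σ₂ σ₃ : Perm m) → HasA π₁ π₂ π₃ → HasA σ₁ σ₂ σ₃ →
               HasA (glue↔ π₁ σ₁) (glue↔ π₂ σ₂) (glue↔ π₃ σ₃)
  glue↔-HasA _ _ _ _ _ _ (π₄ , π₄-to , π₄-from) (σ₄ , σ₄-to , σ₄-from) =
    glue↔ π₄ σ₄ ,
    (λ v → trans (glue-cong π₄-to σ₄-to v) (sym (sum3-glue _ _ _ _ _ _ v))) ,
    (λ v → trans (glue-cong π₄-from σ₄-from v) (sym (sum3-glue _ _ _ _ _ _ v)))

proposition1 : ∀ (m : ℕ) (π₁ π₂ π₃ σ₁ σ₂ σ₃ : Perm m) →
    HasA π₁ π₂ π₃ → HasA σ₁ σ₂ σ₃ →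
    let π₄ = sum3 (Inverse.to π₁) (Inverse.to π₂) (Inverse.to π₃)
        σ₄ = sum3 (Inverse.to σ₁) (Inverse.to σ₂) (Inverse.to σ₃)
    in Σ (Perm (suc m)) λ φ₁ → Σ (Perm (suc m)) λ φ₂ → Σ (Perm (suc m)) λ φ₃ →
         (∀ v → Inverse.to φ₁ v ≡ glue (Inverse.to π₁) (Inverse.to σ₁) v)
         × (∀ v → Inverse.to φ₂ v ≡ glue (Inverse.to π₂) (Inverse.to σ₂) v)
         × (∀ v → Inverse.to φ₃ v ≡ glue (Inverse.to π₃) (Inverse.to σ₃) v)
         × HasA φ₁ φ₂ φ₃
         × (∀ v → sum3 (Inverse.to φ₁) (Inverse.to φ₂) (Inverse.to φ₃) v ≡ glue π₄ σ₄ v)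
proposition1 m π₁ π₂ π₃ σ₁ σ₂ σ₃ π-A σ-A =
  glue↔ π₁ σ₁ , glue↔ π₂ σ₂ , glue↔ π₃ σ₃ ,
  (λ _ → refl) , (λ _ → refl) , (λ _ → refl) ,
  glue↔-HasA π₁ π₂ π₃ σ₁ σ₂ σ₃ π-A σ-A ,
  sum3-glue _ _ _ _ _ _
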